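{- Let $(u,x)$ and $(u,y)$ be Burge words with the same top row $u$. If $x\sim y$, then $\Gamma(u,x)=\Gamma(u,y)$.
   Context: A Cayley permutation of length $n$ is a word of positive integers in which every integer from $1$ to its maximum occurs; $\mathrm{Cay}_n$ is the set of these and $\mathrm{WI}_n$ the weakly increasing ones; $\mathrm{id}_n=12\cdots n$. $\mathrm{Des}(v)=\{i:v(i)\ge v(i+1)\}$. A Burge word is a pair $(u,v)\in\mathrm{WI}_n\times\mathrm{Cay}_n$ with $\mathrm{Des}(u)\subseteq\mathrm{Des}(v)$, viewed as the sequence of columns $\binom{u(i)}{v(i)}$. Its Burge transpose is obtained by turning every column upside down and sorting the columns in increasing order of top entry, ties broken by decreasing bottom entry; write $(u,v)^T=(\mathrm{sort}(v),\Gamma(u,v))$, where $\mathrm{sort}(v)$ is the weakly increasing rearrangement of $v$. Let $\gamma(x)=\Gamma(\mathrm{id}_n,x)$, and $x\sim y$ iff $\gamma(x)=\gamma(y)$. -}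

module Defs where

open import Data.Nat using (ℕ; zero; suc; _≤_; _<_; _≥_; _⊔_; _≤ᵇ_; _<ᵇ_; _≡ᵇ_)
open import Data.Bool using (Bool; true; false; if_then_else_; _∧_; _∨_)
open import Data.List using (List; []; _∷_; length; map; foldr; zip; upTo)
open import Data.List.Membership.Propositional using (_∈_)
open import Data.List.Relation.Unary.All using (All)
open import Data.Product using (_×_; _,_; proj₁; proj₂)
open import Relation.Binary.PropositionalEquality using (_≡_)

-- Words are lists of natural numbers; positions are 0-based below.

maxW : List ℕ → ℕ
maxW = foldr _⊔_ 0

IsCayley : List ℕ → Set
IsCayley w = All (λ a → 1 ≤ a) w × (∀ k → 1 ≤ k → k ≤ maxW w → k ∈ w)

at : List ℕ → ℕ → ℕ
at []       _       = 0
at (a ∷ _)  zero    = a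
at (_ ∷ w)  (suc i) = at w i

InDes : List ℕ → ℕ → Set
InDes w i = suc i < length w × at w i ≥ at w (suc i)

IsWI : List ℕ → Set
IsWI w = ∀ i → suc i < length w → at w i ≤ at w (suc i)

IsBurge : List ℕ → List ℕ → Set
IsBurge u v =
  length u ≡ length v × IsCayley u × IsWI u × IsCayley v × (∀ i → InDes u i → InDes v i)

idW : ℕ → List ℕ
idW n = map suc (upTo n)

-- Ordering of transposed columns (top , bottom): increasing top, ties by decreasing bottom.
-- colLe c d = true iff c may come before (or equal) d.
colLe : ℕ × ℕ → ℕ × ℕ → Bool
colLe (a , b) (c , d) = (a <ᵇ c) ∨ ((a ≡ᵇ c) ∧ (d ≤ᵇ b))

insertCol : ℕ × ℕ → List (ℕ × ℕ) → List (ℕ × ℕ)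
insertCol c []       = c ∷ []
insertCol c (d ∷ ds) = if colLe c d then c ∷ d ∷ ds else d ∷ insertCol c ds

sortCols : List (ℕ × ℕ) → List (ℕ × ℕ)
sortCols = foldr insertCol []

-- Γ(u , v): turn each column (u(i) over v(i)) upside down, giving (v(i) over u(i)),
-- sort by increasing top with ties broken by decreasing bottom, and read the bottom row.
Γ : List ℕ → List ℕ → List ℕ
Γ u v = map proj₂ (sortCols (zip v u))

γ : List ℕ → List ℕ
γ x = Γ (idW (length x)) x

_∼_ : List ℕ → List ℕ → Set
x ∼ y = γ x ≡ γ y

-- Sorting the transposed columns only compares top entries and, among equal tops,
-- bottom entries; relabelling the bottom row by a weakly increasing map g can only
-- turn strict comparisons into ties, and tied columns are then equal.  Hence sorting
-- commutes with relabelling, i.e. Γ(g ∘ v, x) = g ∘ Γ(v, x).  A weakly increasing top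
-- row u is such a relabelling of id_n, so Γ(u, x) = u ∘ γ(x) depends on x only through γ(x).
module Submission where

open import Defs
open import Data.Nat using (ℕ; zero; suc; _≤_; _<_; _⊓_; pred; z≤n; s≤s; _<ᵇ_; _≡ᵇ_; _≤ᵇ_)
open import Data.Nat.Properties
open import Data.Bool using (true; false; T)
open import Data.Bool.Properties using (T-≡)
open import Data.Empty using (⊥-elim)
open import Data.Sum using (_⊎_; inj₁; inj₂)
open import Data.List using (List; []; _∷_; map; zip; length; upTo; applyUpTo)
open import Data.List.Properties using (map-∘; map-id; zip-map)
open import Data.List.Relation.Unary.Linked as Linked using (Linked; []; [-]; _∷_)
open import Data.List.Relation.Unary.Linked.Properties using (map⁺)
open import Data.Product using (_×_; _,_; proj₂; map₂)
open import Function using (_∘_; id)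
open import Function.Bundles using (Equivalence)
open import Relation.Binary.Core using (_Preserves_⟶_)
open import Relation.Binary.Definitions using (tri<; tri≈; tri>)
open import Relation.Binary.PropositionalEquality
open import Relation.Nullary using (¬_)

Col : Set
Col = ℕ × ℕ

_≼_ : Col → Col → Set
c ≼ d = colLe c d ≡ true

private
  fromT : ∀ {b} → T b → b ≡ true
  fromT = Equivalence.to T-≡

  toT : ∀ {b} → b ≡ true → T b
  toT = Equivalence.from T-≡

_⊑_ : Col → Col → Set
(a , b) ⊑ (c , d) = a < c ⊎ (a ≡ c × d ≤ b)

≼⇒⊑ : ∀ x y → x ≼ y → x ⊑ y
≼⇒⊑ (a , b) (c , d) le with a <ᵇ c in a<ᵇc
... | true = inj₁ (<ᵇ⇒< a c (toT a<ᵇc))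
... | false with a ≡ᵇ c in a≡ᵇc
...   | true = inj₂ (≡ᵇ⇒≡ a c (toT a≡ᵇc) , ≤ᵇ⇒≤ d b (toT le))

⊑⇒≼ : ∀ x y → x ⊑ y → x ≼ y
⊑⇒≼ (a , b) (c , d) x⊑y with a <ᵇ c in a<ᵇc | x⊑y
... | true  | _ = refl
... | false | inj₁ a<c with () ← trans (sym (fromT (<⇒<ᵇ a<c))) a<ᵇc
... | false | inj₂ (a≡c , d≤b) with a ≡ᵇ c in a≡ᵇc
...   | true  = fromT (≤⇒≤ᵇ d≤b)
...   | false with () ← trans (sym (fromT (≡⇒≡ᵇ a c a≡c))) a≡ᵇc

≰⇒⋢ : ∀ x y → colLe x y ≡ false → ¬ x ⊑ y
≰⇒⋢ x y eq x⊑y with () ← trans (sym eq) (⊑⇒≼ x y x⊑y)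

≰⇒≽ : ∀ x y → colLe x y ≡ false → y ≼ x
≰⇒≽ x@(a , b) y@(c , d) eq with <-cmp a c
... | tri< a<c _ _ = ⊥-elim (≰⇒⋢ x y eq (inj₁ a<c))
... | tri> _ _ c<a = ⊑⇒≼ y x (inj₁ c<a)
... | tri≈ _ refl _ = ⊑⇒≼ y x (inj₂ (refl , ≰⇒≥ (λ d≤b → ≰⇒⋢ x y eq (inj₂ (refl , d≤b)))))

module _ {g : ℕ → ℕ} (mono : g Preserves _≤_ ⟶ _≤_) where

  ≼-map₂ : ∀ x y → x ≼ y → map₂ g x ≼ map₂ g y
  ≼-map₂ x@(a , b) y@(c , d) le with ≼⇒⊑ x y le
  ... | inj₁ a<c = ⊑⇒≼ (map₂ g x) (map₂ g y) (inj₁ a<c)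
  ... | inj₂ (a≡c , d≤b) = ⊑⇒≼ (map₂ g x) (map₂ g y) (inj₂ (a≡c , mono d≤b))

  ≰∧≼-map₂⇒≡ : ∀ x y → colLe x y ≡ false → map₂ g x ≼ map₂ g y → map₂ g x ≡ map₂ g y
  ≰∧≼-map₂⇒≡ x@(a , b) y@(c , d) eq le with ≼⇒⊑ (map₂ g x) (map₂ g y) le
  ... | inj₁ a<c = ⊥-elim (≰⇒⋢ x y eq (inj₁ a<c))
  ... | inj₂ (refl , gd≤gb) =
    cong (a ,_) (≤-antisym (mono (≰⇒≥ (λ d≤b → ≰⇒⋢ x y eq (inj₂ (refl , d≤b))))) gd≤gb)

Sorted : List Col → Set
Sorted = Linked _≼_

insertCol-sorted-∷ : ∀ {e} c ds → e ≼ c → Sorted (e ∷ ds) → Sorted (e ∷ insertCol c ds)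
insertCol-sorted-∷ c []       e≼c _ = e≼c ∷ [-]
insertCol-sorted-∷ c (d ∷ ds) e≼c (e≼d ∷ s) with colLe c d in c≼d
... | true  = e≼c ∷ c≼d ∷ s
... | false = e≼d ∷ insertCol-sorted-∷ c ds (≰⇒≽ c d c≼d) s

insertCol-sorted : ∀ c ds → Sorted ds → Sorted (insertCol c ds)
insertCol-sorted c []       _ = [-]
insertCol-sorted c (d ∷ ds) s with colLe c d in c≼d
... | true  = c≼d ∷ s
... | false = insertCol-sorted-∷ c ds (≰⇒≽ c d c≼d) s

sortCols-sorted : ∀ cs → Sorted (sortCols cs)
sortCols-sorted []       = []
sortCols-sorted (c ∷ cs) = insertCol-sorted c (sortCols cs) (sortCols-sorted cs)

insertCol-head : ∀ c ds → Sorted (c ∷ ds) → insertCol c ds ≡ c ∷ ds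
insertCol-head c []       _         = refl
insertCol-head c (d ∷ ds) (c≼d ∷ _) rewrite c≼d = refl

module _ {g : ℕ → ℕ} (mono : g Preserves _≤_ ⟶ _≤_) where

  insertCol-map₂ : ∀ c ds → Sorted ds →
                   insertCol (map₂ g c) (map (map₂ g) ds) ≡ map (map₂ g) (insertCol c ds)
  insertCol-map₂ c []       _ = refl
  insertCol-map₂ c (d ∷ ds) s with colLe c d in c≼d | colLe (map₂ g c) (map₂ g d) in gc≼gd
  ... | true  | true  = refl
  ... | true  | false with () ← trans (sym gc≼gd) (≼-map₂ mono c d c≼d)
  ... | false | false = cong (map₂ g d ∷_) (insertCol-map₂ c ds (Linked.tail s))
  ... | false | true  = begin
      gc ∷ gd ∷ gds              ≡⟨ cong₂ _∷_ gc≡gd (cong (_∷ gds) (sym gc≡gd)) ⟩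
      gd ∷ gc ∷ gds              ≡⟨ cong (gd ∷_) (sym (insertCol-head gc gds gc∷gds-sorted)) ⟩
      gd ∷ insertCol gc gds      ≡⟨ cong (gd ∷_) (insertCol-map₂ c ds (Linked.tail s)) ⟩
      gd ∷ map (map₂ g) (insertCol c ds) ∎
    where
      open ≡-Reasoning
      gc = map₂ g c
      gd = map₂ g d
      gds = map (map₂ g) ds
      gc≡gd : gc ≡ gd
      gc≡gd = ≰∧≼-map₂⇒≡ mono c d c≼d gc≼gd
      gc∷gds-sorted : Sorted (gc ∷ gds)
      gc∷gds-sorted = subst (λ e → Sorted (e ∷ gds)) (sym gc≡gd)
                            (map⁺ (Linked.map (λ {x} {y} → ≼-map₂ mono x y) s))

  sortCols-map₂ : ∀ cs → sortCols (map (map₂ g) cs) ≡ map (map₂ g) (sortCols cs)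
  sortCols-map₂ []       = refl
  sortCols-map₂ (c ∷ cs) = begin
    insertCol (map₂ g c) (sortCols (map (map₂ g) cs))   ≡⟨ cong (insertCol (map₂ g c)) (sortCols-map₂ cs) ⟩
    insertCol (map₂ g c) (map (map₂ g) (sortCols cs))   ≡⟨ insertCol-map₂ c (sortCols cs) (sortCols-sorted cs) ⟩
    map (map₂ g) (insertCol c (sortCols cs))            ∎
    where open ≡-Reasoning

  Γ-map : ∀ v x → Γ (map g v) x ≡ map g (Γ v x)
  Γ-map v x = begin
    map proj₂ (sortCols (zip x (map g v)))                  ≡⟨ cong (λ w → map proj₂ (sortCols (zip w (map g v)))) (sym (map-id x)) ⟩
    map proj₂ (sortCols (zip (map id x) (map g v)))         ≡⟨ cong (map proj₂ ∘ sortCols) (zip-map id g x v) ⟩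
    map proj₂ (sortCols (map (map₂ g) (zip x v)))           ≡⟨ cong (map proj₂) (sortCols-map₂ (zip x v)) ⟩
    map proj₂ (map (map₂ g) (sortCols (zip x v)))           ≡⟨ sym (map-∘ (sortCols (zip x v))) ⟩
    map (g ∘ proj₂) (sortCols (zip x v))                    ≡⟨ map-∘ (sortCols (zip x v)) ⟩
    map g (map proj₂ (sortCols (zip x v)))                  ∎
    where open ≡-Reasoning

at-mono : ∀ u → IsWI u → ∀ {i j} → i ≤ j → j < length u → at u i ≤ at u j
at-mono u wi {j = zero}  z≤n _ = ≤-refl
at-mono u wi {j = suc j} i≤1+j 1+j<n with m≤n⇒m<n∨m≡n i≤1+j
... | inj₂ refl      = ≤-refl
... | inj₁ (s≤s i≤j) = ≤-trans (at-mono u wi i≤j (<-trans (n<1+n j) 1+j<n)) (wi j 1+j<n)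

-- u read as a function of the 1-based positions 1 … n, with every argument clamped
-- into that range so that it stays weakly increasing on all of ℕ.
atClamped : List ℕ → ℕ → ℕ
atClamped u k = at u (pred k ⊓ pred (length u))

atClamped-mono : ∀ u → IsWI u → atClamped u Preserves _≤_ ⟶ _≤_
atClamped-mono []      _  _ = z≤n
atClamped-mono (a ∷ u) wi {i} {j} i≤j =
  at-mono (a ∷ u) wi (⊓-monoˡ-≤ (length u) (pred-mono-≤ i≤j)) (s≤s (m⊓n≤n (pred j) (length u)))

map-applyUpTo : ∀ {A : Set} (f : ℕ → A) (g : ℕ → ℕ) n → map f (applyUpTo g n) ≡ applyUpTo (f ∘ g) n
map-applyUpTo f g zero    = refl
map-applyUpTo f g (suc n) = cong (f (g 0) ∷_) (map-applyUpTo f (g ∘ suc) n)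

applyUpTo-at : ∀ u (f : ℕ → ℕ) → (∀ i → i < length u → f i ≡ at u i) → applyUpTo f (length u) ≡ u
applyUpTo-at []      f f≗u = refl
applyUpTo-at (a ∷ u) f f≗u =
  cong₂ _∷_ (f≗u 0 (s≤s z≤n)) (applyUpTo-at u (f ∘ suc) (λ i i<n → f≗u (suc i) (s≤s i<n)))

map-atClamped-idW : ∀ u → map (atClamped u) (idW (length u)) ≡ u
map-atClamped-idW u = begin
  map (atClamped u) (map suc (upTo n))   ≡⟨ map-∘ (upTo n) ⟨
  map (atClamped u ∘ suc) (upTo n)       ≡⟨ map-applyUpTo (atClamped u ∘ suc) id n ⟩
  applyUpTo (atClamped u ∘ suc) n        ≡⟨ applyUpTo-at u (atClamped u ∘ suc) (λ i i<n → cong (at u) (m≤n⇒m⊓n≡m (<⇒≤pred i<n))) ⟩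
  u                                      ∎
  where
    open ≡-Reasoning
    n = length u

Γ≡map-atClamped-γ : ∀ u x → IsWI u → length u ≡ length x → Γ u x ≡ map (atClamped u) (γ x)
Γ≡map-atClamped-γ u x wi n≡|x| = begin
  Γ u x                                            ≡⟨ cong (λ v → Γ v x) (sym (map-atClamped-idW u)) ⟩
  Γ (map (atClamped u) (idW (length u))) x         ≡⟨ Γ-map (atClamped-mono u wi) (idW (length u)) x ⟩
  map (atClamped u) (Γ (idW (length u)) x)         ≡⟨ cong (λ n → map (atClamped u) (Γ (idW n) x)) n≡|x| ⟩
  map (atClamped u) (γ x)                          ∎
  where open ≡-Reasoning

mainTheorem17 : (u x y : List ℕ) → IsBurge u x → IsBurge u y → x ∼ y → Γ u x ≡ Γ u y
mainTheorem17 u x y (n≡|x| , _ , wi , _) (n≡|y| , _) γx≡γy = begin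
  Γ u x                    ≡⟨ Γ≡map-atClamped-γ u x wi n≡|x| ⟩
  map (atClamped u) (γ x)  ≡⟨ cong (map (atClamped u)) γx≡γy ⟩
  map (atClamped u) (γ y)  ≡⟨ Γ≡map-atClamped-γ u y wi n≡|y| ⟨
  Γ u y                    ∎
  where open ≡-Reasoning
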